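{- For any integer $d\geq 2$, $\liminf_{n\to\infty}\frac{\beta_n^d}{n^d}\geq\frac{1}{d!\,\zeta(d)}$, where $\zeta$ is the Riemann zeta function.
   Context: $\mathbb{Z}_n$ is the ring of integers modulo $n$, identified with $\{0,\dots,n-1\}$; a vector $(v_1,\dots,v_d)\in\mathbb{Z}_n^d$ is zero-sum-free if no non-empty subset of its components sums to $0$ in $\mathbb{Z}_n$; $\beta_n^d$ is the number of zero-sum-free $(x_1,\dots,x_d)\in\mathbb{Z}_n^d$ with $\gcd(x_1,\dots,x_d,n)=1$. -}

module Defs where

open import Data.Nat as ℕ using (ℕ; zero; suc; _+_; _^_; _!; NonZero)
open import Data.Nat.Properties using (m^n≢0)
open import Data.Nat.Divisibility using (_∣_; _∣?_)
open import Data.Nat.GCD using (gcd)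
open import Data.Fin using (Fin; toℕ)
open import Data.Fin.Subset using (Subset; Nonempty; inside; outside)
open import Data.Fin.Subset.Properties using (nonempty?)
open import Data.Vec using (Vec; []; _∷_; foldr)
open import Data.List using (List; [_]; concatMap; map; length; filter; allFin)
open import Data.Integer using (+_)
open import Data.Rational using (ℚ; _/_; 0ℚ)
import Data.Rational as ℚ
open import Data.Product using (_×_; _,_)
open import Relation.Nullary using (Dec; yes; no; ¬_)
open import Relation.Nullary.Decidable using (_×-dec_; ¬?; _→-dec_)
open import Relation.Binary.PropositionalEquality using (_≡_)

-- Elements of ℤ_n are represented by Fin n = {0,…,n-1}.

subsetSum : ∀ {d n} → Subset d → Vec (Fin n) d → ℕ
subsetSum []            []      = 0
subsetSum (inside ∷ s)  (x ∷ v) = toℕ x + subsetSum s v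
subsetSum (outside ∷ s) (x ∷ v) = subsetSum s v

-- v is zero-sum-free in ℤ_n: no non-empty subset of its components
-- sums to 0 modulo n (i.e. the ℕ-sum is not divisible by n).
ZeroSumFree : ∀ {d} (n : ℕ) → Vec (Fin n) d → Set
ZeroSumFree n v = ∀ s → Nonempty s → ¬ (n ∣ subsetSum s v)

GcdOne : ∀ {d} (n : ℕ) → Vec (Fin n) d → Set
GcdOne n v = foldr (λ _ → ℕ) (λ x g → gcd (toℕ x) g) n v ≡ 1

allSubset? : ∀ {d} {P : Subset d → Set} → (∀ s → Dec (P s)) → Dec (∀ s → P s)
allSubset? {zero} {P} dec with dec []
... | yes p = yes λ { [] → p }
... | no ¬p = no λ f → ¬p (f [])
allSubset? {suc d} {P} dec
  with allSubset? {d} {λ s → P (inside ∷ s)} (λ s → dec (inside ∷ s))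
     | allSubset? {d} {λ s → P (outside ∷ s)} (λ s → dec (outside ∷ s))
... | yes p | yes q = yes λ { (inside ∷ s) → p s ; (outside ∷ s) → q s }
... | no ¬p | _     = no λ f → ¬p (λ s → f (inside ∷ s))
... | yes _ | no ¬q = no λ f → ¬q (λ s → f (outside ∷ s))

zeroSumFree? : ∀ {d} (n : ℕ) (v : Vec (Fin n) d) → Dec (ZeroSumFree n v)
zeroSumFree? n v = allSubset? λ s → nonempty? s →-dec ¬? (n ∣? subsetSum s v)

gcdOne? : ∀ {d} (n : ℕ) (v : Vec (Fin n) d) → Dec (GcdOne n v)
gcdOne? n v = foldr (λ _ → ℕ) (λ x g → gcd (toℕ x) g) n v ℕ.≟ 1

allVecs : ∀ d n → List (Vec (Fin n) d)
allVecs zero    n = [ [] ]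
allVecs (suc d) n = concatMap (λ i → map (i ∷_) (allVecs d n)) (allFin n)

β : (n d : ℕ) → ℕ
β n d = length (filter (λ v → zeroSumFree? n v ×-dec gcdOne? n v) (allVecs d n))

toℚ : ℕ → ℚ
toℚ k = + k / 1

ζPartial : ℕ → ℕ → ℚ
ζPartial d zero    = 0ℚ
ζPartial d (suc N) = ζPartial d N ℚ.+ (_/_ (+ 1) (suc N ^ d) {{m^n≢0 (suc N) d}})

module Submission where

-- Write n = m + 1 and read ℤₙ as {0,…,m}. A vector whose coordinates are positive with sum at most m
-- is zero-sum-free, and so is one whose negatives n − xᵢ are; for d ≥ 2 these two simplices are
-- disjoint, and each has simplex 1 d m ≥ (m − d)^d / d! points. A point with gcd(x, n) ≠ 1 has all
-- coordinates and n divisible by 2 or by an odd g ≥ 3, and at most m^d / (d! g^d) ≤ m^d / (d! g²)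
-- points have this for a given g. As 1/4 + ∑_{g odd ≥ 3} 1/g² < 0.495, this gives
-- d!·β ≥ 2(m − d)^d − 0.99·m^d ≥ (m + 1)^d once m > 1001 d². So β_n^d ≥ n^d / d! eventually, which
-- is more than claimed: the hypothesis is only used at N = 1, where the partial sum of ζ(d) is 1.

open import Defs
open import Function using (_∘_)
open import Data.Empty using (⊥; ⊥-elim)
open import Data.Unit using (⊤; tt)
open import Data.Product using (_×_; _,_; ∃-syntax)
open import Data.Sum using (_⊎_; inj₁; inj₂)
open import Relation.Nullary using (Dec; yes; no; ¬_; _×-dec_)
open import Relation.Binary.PropositionalEquality
open import Data.Nat
open import Data.Nat.Properties
open import Data.Nat.Divisibility
  using (_∣_; _∣?_; 1∣_; ∣-refl; ∣-trans; ∣⇒≤; ∣m+n∣m⇒∣n; m∣m*n; n∣m*n; m%n≡0⇒n∣m; n∣m⇒m%n≡0)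
open import Data.Nat.DivMod using (%-distribˡ-+; m<n⇒m%n≡m; m%n<n; n%n≡0; %-pred-≡0)
open import Data.Nat.GCD using (gcd; gcd[m,n]∣m; gcd[m,n]∣n)
open import Data.Nat.Coprimality using (1-coprimeTo)
import Data.Nat.Coprimality as Coprime
open import Data.Nat.ListAction using (sum)
open import Data.Nat.ListAction.Properties using (sum-++)
open import Data.Nat.Tactic.RingSolver using (solve-∀)
import Algebra.Properties.CommutativeSemigroup as CommSemigroupProperties
open CommSemigroupProperties +-commutativeSemigroup using () renaming (interchange to +-interchange)
open CommSemigroupProperties *-commutativeSemigroup using ()
  renaming (x∙yz≈y∙xz to x*[y*z]≡y*[x*z]; xy∙z≈y∙xz to x*y*z≡y*[x*z])
open import Data.List using (List; []; _∷_; map; concatMap; _++_; length; filter; tabulate; allFin)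
open import Data.List.Properties using (map-++)
open import Data.Fin using (Fin; toℕ; zero; suc)
open import Data.Fin.Properties using (toℕ<n)
open import Data.Fin.Subset using (Subset; Nonempty; inside; outside; ∣_∣)
import Data.Fin.Subset as Subset
open import Data.Fin.Subset.Properties using (drop-there; ∣⊤∣≡n)
open import Data.Vec using (Vec; []; _∷_; foldr)
open import Data.Vec.Relation.Unary.All using (All; []; _∷_)
import Data.Vec.Relation.Unary.All as All
import Data.Integer as ℤ
import Data.Integer.Properties as ℤP
open import Data.Rational using (ℚ; mkℚ; 0ℚ; 1ℚ)
import Data.Rational as ℚ
import Data.Rational.Properties as ℚP

∑< : ℕ → (ℕ → ℕ) → ℕ
∑< zero    f = 0
∑< (suc k) f = f 0 + ∑< k (f ∘ suc)

infix 5 ∑<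
syntax ∑< k (λ v → e) = ∑[ v < k ] e

∑<-last : ∀ k (f : ℕ → ℕ) → ∑< (suc k) f ≡ ∑< k f + f k
∑<-last zero    f = +-comm (f 0) 0
∑<-last (suc k) f = trans (cong (f 0 +_) (∑<-last k (f ∘ suc))) (sym (+-assoc (f 0) _ _))

∑<-cong : ∀ k {f g : ℕ → ℕ} → (∀ v → v < k → f v ≡ g v) → ∑< k f ≡ ∑< k g
∑<-cong zero    eq = refl
∑<-cong (suc k) eq = cong₂ _+_ (eq 0 z<s) (∑<-cong k (λ v v<k → eq (suc v) (s<s v<k)))

∑<-zero : ∀ k → ∑[ v < k ] 0 ≡ 0
∑<-zero zero    = refl
∑<-zero (suc k) = ∑<-zero k

∑<-mono : ∀ k {f g : ℕ → ℕ} → (∀ v → f v ≤ g v) → ∑< k f ≤ ∑< k g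
∑<-mono zero    le = z≤n
∑<-mono (suc k) le = +-mono-≤ (le 0) (∑<-mono k (le ∘ suc))

∑<-*ˡ : ∀ k c (f : ℕ → ℕ) → ∑[ v < k ] c * f v ≡ c * ∑< k f
∑<-*ˡ zero    c f = sym (*-zeroʳ c)
∑<-*ˡ (suc k) c f = trans (cong (c * f 0 +_) (∑<-*ˡ k c (f ∘ suc))) (sym (*-distribˡ-+ c (f 0) _))

f≤∑< : ∀ {j} k (f : ℕ → ℕ) → j < k → f j ≤ ∑< k f
f≤∑< {zero}  (suc k) f _         = m≤m+n (f 0) _
f≤∑< {suc j} (suc k) f (s<s j<k) = ≤-trans (f≤∑< k (f ∘ suc) j<k) (m≤n+m _ (f 0))

∑<-+ : ∀ k l (f : ℕ → ℕ) → ∑< (k + l) f ≡ ∑< k f + (∑[ v < l ] f (k + v))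
∑<-+ zero    l f = refl
∑<-+ (suc k) l f = trans (cong (f 0 +_) (∑<-+ k l (f ∘ suc))) (sym (+-assoc (f 0) _ _))

∑<-monoˡ : ∀ {k l} (f : ℕ → ℕ) → k ≤ l → ∑< k f ≤ ∑< l f
∑<-monoˡ {k} f k≤l with l′ , refl ← m≤n⇒∃[o]m+o≡n k≤l = begin
  ∑< k f                            ≤⟨ m≤m+n (∑< k f) _ ⟩
  ∑< k f + (∑[ v < l′ ] f (k + v))  ≡⟨ ∑<-+ k l′ f ⟨
  ∑< (k + l′) f                     ∎
  where open ≤-Reasoning

∑<-cut : ∀ {m k} (f : ℕ → ℕ) → m ≤ k → (∀ v → m ≤ v → f v ≡ 0) → ∑< k f ≡ ∑< m f
∑<-cut {m} f m≤k vanish with l , refl ← m≤n⇒∃[o]m+o≡n m≤k = begin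
  ∑< (m + l) f                     ≡⟨ ∑<-+ m l f ⟩
  ∑< m f + (∑[ v < l ] f (m + v))  ≡⟨ cong (∑< m f +_) (tail l) ⟩
  ∑< m f + 0                       ≡⟨ +-identityʳ _ ⟩
  ∑< m f                           ∎
  where
  open ≡-Reasoning
  tail : ∀ l → ∑[ v < l ] f (m + v) ≡ 0
  tail l = trans (∑<-cong l (λ v _ → vanish (m + v) (m≤m+n m v))) (∑<-zero l)

∑<-reverse : ∀ k (f : ℕ → ℕ) → ∑[ v < k ] f (k ∸ suc v) ≡ ∑< k f
∑<-reverse zero    f = refl
∑<-reverse (suc k) f = begin
  f k + (∑[ v < k ] f (k ∸ suc v))  ≡⟨ cong (f k +_) (∑<-reverse k f) ⟩
  f k + ∑< k f                      ≡⟨ +-comm (f k) _ ⟩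
  ∑< k f + f k                      ≡⟨ ∑<-last k f ⟨
  ∑< (suc k) f                      ∎
  where open ≡-Reasoning

∑∈ : {A : Set} → (A → ℕ) → List A → ℕ
∑∈ w xs = sum (map w xs)

infix 5 ∑∈
syntax ∑∈ (λ x → e) xs = ∑[ x ∈ xs ] e

module _ {A : Set} where

  ∑∈-cong : ∀ {w w′ : A → ℕ} xs → (∀ x → w x ≡ w′ x) → ∑∈ w xs ≡ ∑∈ w′ xs
  ∑∈-cong []       eq = refl
  ∑∈-cong (x ∷ xs) eq = cong₂ _+_ (eq x) (∑∈-cong xs eq)

  ∑∈-mono : ∀ {w w′ : A → ℕ} xs → (∀ x → w x ≤ w′ x) → ∑∈ w xs ≤ ∑∈ w′ xs
  ∑∈-mono []       le = z≤n
  ∑∈-mono (x ∷ xs) le = +-mono-≤ (le x) (∑∈-mono xs le)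

  ∑∈-+ : ∀ (w w′ : A → ℕ) xs → ∑[ x ∈ xs ] (w x + w′ x) ≡ ∑∈ w xs + ∑∈ w′ xs
  ∑∈-+ w w′ []       = refl
  ∑∈-+ w w′ (x ∷ xs) = trans (cong (w x + w′ x +_) (∑∈-+ w w′ xs)) (+-interchange (w x) (w′ x) _ _)

  ∑∈-*ˡ : ∀ c (w : A → ℕ) xs → ∑[ x ∈ xs ] c * w x ≡ c * ∑∈ w xs
  ∑∈-*ˡ c w []       = sym (*-zeroʳ c)
  ∑∈-*ˡ c w (x ∷ xs) = trans (cong (c * w x +_) (∑∈-*ˡ c w xs)) (sym (*-distribˡ-+ c (w x) _))

  ∑∈-∑< : ∀ k (f : ℕ → A → ℕ) xs → ∑[ x ∈ xs ] (∑[ j < k ] f j x) ≡ ∑[ j < k ] ∑∈ (f j) xs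
  ∑∈-∑< zero    f xs = ∑∈-zero xs
    where
    ∑∈-zero : ∀ xs → ∑[ x ∈ xs ] 0 ≡ 0
    ∑∈-zero []       = refl
    ∑∈-zero (x ∷ xs) = ∑∈-zero xs
  ∑∈-∑< (suc k) f xs = trans (∑∈-+ (f 0) _ xs) (cong (∑∈ (f 0) xs +_) (∑∈-∑< k (f ∘ suc) xs))

  ∑∈-tabulate : ∀ {k} (f : Fin k → A) (w : A → ℕ) (h : ℕ → ℕ) → (∀ i → w (f i) ≡ h (toℕ i)) →
                ∑∈ w (tabulate f) ≡ ∑< k h
  ∑∈-tabulate {zero}  f w h eq = refl
  ∑∈-tabulate {suc k} f w h eq = cong₂ _+_ (eq zero) (∑∈-tabulate (f ∘ suc) w (h ∘ suc) (eq ∘ suc))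

  ∑∈-concatMap : ∀ {B : Set} (w : B → ℕ) (F : A → List B) xs → ∑∈ w (concatMap F xs) ≡ ∑[ x ∈ xs ] ∑∈ w (F x)
  ∑∈-concatMap w F []       = refl
  ∑∈-concatMap w F (x ∷ xs) = begin
    sum (map w (F x ++ concatMap F xs))           ≡⟨ cong sum (map-++ w (F x) _) ⟩
    sum (map w (F x) ++ map w (concatMap F xs))   ≡⟨ sum-++ (map w (F x)) _ ⟩
    ∑∈ w (F x) + ∑∈ w (concatMap F xs)            ≡⟨ cong (∑∈ w (F x) +_) (∑∈-concatMap w F xs) ⟩
    ∑∈ w (F x) + (∑[ x ∈ xs ] ∑∈ w (F x))         ∎
    where open ≡-Reasoning

  ∑∈-map : ∀ {B : Set} (w : B → ℕ) (g : A → B) xs → ∑∈ w (map g xs) ≡ ∑∈ (w ∘ g) xs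
  ∑∈-map w g []       = refl
  ∑∈-map w g (x ∷ xs) = cong (w (g x) +_) (∑∈-map w g xs)

𝟙 : {P : Set} → Dec P → ℕ
𝟙 (yes _) = 1
𝟙 (no _)  = 0

𝟙-yes : ∀ {P : Set} (p? : Dec P) → P → 𝟙 p? ≡ 1
𝟙-yes (yes _) _ = refl
𝟙-yes (no ¬p) p = ⊥-elim (¬p p)

𝟙-no : ∀ {P : Set} (p? : Dec P) → ¬ P → 𝟙 p? ≡ 0
𝟙-no (yes p) ¬p = ⊥-elim (¬p p)
𝟙-no (no _)  _  = refl

1≤𝟙 : ∀ {P : Set} (p? : Dec P) → P → 1 ≤ 𝟙 p?
1≤𝟙 p? p = ≤-reflexive (sym (𝟙-yes p? p))

𝟙-mono : ∀ {P Q : Set} (p? : Dec P) (q? : Dec Q) → (P → Q) → 𝟙 p? ≤ 𝟙 q?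
𝟙-mono (yes p) q? f = ≤-reflexive (sym (𝟙-yes q? (f p)))
𝟙-mono (no _)  q? f = z≤n

𝟙-cong : ∀ {P Q : Set} (p? : Dec P) (q? : Dec Q) → (P → Q) → (Q → P) → 𝟙 p? ≡ 𝟙 q?
𝟙-cong p? q? f g = ≤-antisym (𝟙-mono p? q? f) (𝟙-mono q? p? g)

𝟙-× : ∀ {P Q : Set} (p? : Dec P) (q? : Dec Q) → 𝟙 (p? ×-dec q?) ≡ 𝟙 p? * 𝟙 q?
𝟙-× (yes _) (yes _) = refl
𝟙-× (yes _) (no _)  = refl
𝟙-× (no _)  _       = refl

𝟙-disjoint : ∀ {P Q R : Set} (p? : Dec P) (q? : Dec Q) (r? : Dec R) →
             (P → R) → (Q → R) → (P → Q → ⊥) → 𝟙 p? + 𝟙 q? ≤ 𝟙 r?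
𝟙-disjoint (yes p) (yes q) r? _ _ pq = ⊥-elim (pq p q)
𝟙-disjoint (yes p) (no _)  r? f _ _  = ≤-reflexive (sym (𝟙-yes r? (f p)))
𝟙-disjoint (no _)  q?      r? _ g _  = 𝟙-mono q? r? g

length-filter : ∀ {A : Set} {P : A → Set} (P? : ∀ x → Dec (P x)) xs → length (filter P? xs) ≡ ∑[ x ∈ xs ] 𝟙 (P? x)
length-filter P? []       = refl
length-filter P? (x ∷ xs) with P? x
... | yes _ = cong suc (length-filter P? xs)
... | no _  = length-filter P? xs

-- Lattice points in simplices

[1+d]*a^d+a^[1+d]≤[1+a]^[1+d] : ∀ d a → suc d * a ^ d + a ^ suc d ≤ suc a ^ suc d
[1+d]*a^d+a^[1+d]≤[1+a]^[1+d] zero    a = ≤-refl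
[1+d]*a^d+a^[1+d]≤[1+a]^[1+d] (suc d) a = begin
  suc (suc d) * a ^ suc d + a ^ suc (suc d)  ≤⟨ ≤-trans (m≤m+n _ (suc d * a ^ d)) (≤-reflexive (expand d a (a ^ d))) ⟩
  suc a * (suc d * a ^ d + a ^ suc d)        ≤⟨ *-monoʳ-≤ (suc a) ([1+d]*a^d+a^[1+d]≤[1+a]^[1+d] d a) ⟩
  suc a ^ suc (suc d)                        ∎
  where
  open ≤-Reasoning
  expand : ∀ d a p → (2 + d) * (a * p) + a * (a * p) + (1 + d) * p ≡ (1 + a) * ((1 + d) * p + a * p)
  expand = solve-∀

[1+b]^[1+d]≤[1+d]*[1+b]^d+b^[1+d] : ∀ d b → suc b ^ suc d ≤ suc d * suc b ^ d + b ^ suc d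
[1+b]^[1+d]≤[1+d]*[1+b]^d+b^[1+d] zero    b = ≤-refl
[1+b]^[1+d]≤[1+d]*[1+b]^d+b^[1+d] (suc d) b = begin
  suc b ^ suc (suc d)                                      ≤⟨ *-monoʳ-≤ (suc b) ([1+b]^[1+d]≤[1+d]*[1+b]^d+b^[1+d] d b) ⟩
  suc b * (suc d * suc b ^ d + b ^ suc d)                  ≡⟨ expand d b (suc b ^ d) (b ^ suc d) ⟩
  suc d * suc b ^ suc d + b ^ suc (suc d) + b ^ suc d      ≤⟨ +-monoʳ-≤ _ (^-monoˡ-≤ (suc d) (n≤1+n b)) ⟩
  suc d * suc b ^ suc d + b ^ suc (suc d) + suc b ^ suc d  ≡⟨ collect d b (suc b ^ d) (b ^ suc d) ⟩
  suc (suc d) * suc b ^ suc d + b ^ suc (suc d)            ∎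
  where
  open ≤-Reasoning
  expand : ∀ d b p q → (1 + b) * ((1 + d) * p + q) ≡ (1 + d) * ((1 + b) * p) + b * q + q
  expand = solve-∀
  collect : ∀ d b p q → (1 + d) * ((1 + b) * p) + b * q + (1 + b) * p ≡ (2 + d) * ((1 + b) * p) + b * q
  collect = solve-∀

[1+d]*∑w^d≤m^[1+d] : ∀ d m → suc d * (∑[ w < m ] w ^ d) ≤ m ^ suc d
[1+d]*∑w^d≤m^[1+d] d zero    = ≤-reflexive (*-zeroʳ d)
[1+d]*∑w^d≤m^[1+d] d (suc m) = begin
  suc d * ∑< (suc m) (_^ d)              ≡⟨ cong (suc d *_) (∑<-last m (_^ d)) ⟩
  suc d * (∑< m (_^ d) + m ^ d)          ≡⟨ *-distribˡ-+ (suc d) _ (m ^ d) ⟩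
  suc d * ∑< m (_^ d) + suc d * m ^ d    ≤⟨ +-monoˡ-≤ _ ([1+d]*∑w^d≤m^[1+d] d m) ⟩
  m ^ suc d + suc d * m ^ d              ≡⟨ +-comm (m ^ suc d) _ ⟩
  suc d * m ^ d + m ^ suc d              ≤⟨ [1+d]*a^d+a^[1+d]≤[1+a]^[1+d] d m ⟩
  suc m ^ suc d                          ∎
  where open ≤-Reasoning

[m∸[1+d]]^[1+d]≤[1+d]*∑[w∸d]^d : ∀ d m → (m ∸ suc d) ^ suc d ≤ suc d * (∑[ w < m ] (w ∸ d) ^ d)
[m∸[1+d]]^[1+d]≤[1+d]*∑[w∸d]^d d zero    = z≤n
[m∸[1+d]]^[1+d]≤[1+d]*∑[w∸d]^d d (suc m) with m ∸ d in eq
... | zero  = z≤n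
... | suc b = begin
  suc b ^ suc d                       ≤⟨ [1+b]^[1+d]≤[1+d]*[1+b]^d+b^[1+d] d b ⟩
  suc d * suc b ^ d + b ^ suc d       ≤⟨ +-monoʳ-≤ _ (subst (λ x → x ^ suc d ≤ suc d * ∑< m F) m∸[1+d]≡b ([m∸[1+d]]^[1+d]≤[1+d]*∑[w∸d]^d d m)) ⟩
  suc d * suc b ^ d + suc d * ∑< m F  ≡⟨ *-distribˡ-+ (suc d) (suc b ^ d) (∑< m F) ⟨
  suc d * (suc b ^ d + ∑< m F)        ≡⟨ cong (suc d *_) (+-comm _ (∑< m F)) ⟩
  suc d * (∑< m F + suc b ^ d)        ≡⟨ cong (λ x → suc d * (∑< m F + x ^ d)) eq ⟨
  suc d * (∑< m F + (m ∸ d) ^ d)      ≡⟨ cong (suc d *_) (∑<-last m F) ⟨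
  suc d * ∑< (suc m) F                ∎
  where
  open ≤-Reasoning
  F : ℕ → ℕ
  F w = (w ∸ d) ^ d
  m∸[1+d]≡b : m ∸ suc d ≡ b
  m∸[1+d]≡b = trans (sym (pred[m∸n]≡m∸[1+n] m d)) (cong pred eq)

[1+m]%n≡1+[m%n] : ∀ m n .{{_ : NonZero n}} → ¬ n ∣ suc m → suc m % n ≡ suc (m % n)
[1+m]%n≡1+[m%n] m 1               1∤ = ⊥-elim (1∤ (1∣ suc m))
[1+m]%n≡1+[m%n] m n@(suc (suc _)) n∤ with suc (m % n) <? n
... | yes lt = trans (%-distribˡ-+ 1 m n) (m<n⇒m%n≡m lt)
... | no ¬lt = ⊥-elim (n∤ (m%n≡0⇒n∣m (suc m) n (begin
  suc m % n           ≡⟨ %-distribˡ-+ 1 m n ⟩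
  suc (m % n) % n     ≡⟨ cong (_% n) (≤-antisym (m%n<n m n) (≮⇒≥ ¬lt)) ⟩
  n % n               ≡⟨ n%n≡0 n ⟩
  0                   ∎)))
  where open ≡-Reasoning

-- The g + 1 terms h v of the block ending at a multiple u + 1 of g + 1 are each ≥ h u; the invariant
-- holds back the N mod (g + 1) terms of the unfinished block.
∑-multiples≤ : ∀ g (h : ℕ → ℕ) → (∀ u → h (suc u) ≤ h u) → ∀ N →
               suc g * (∑[ u < N ] 𝟙 (suc g ∣? suc u) * h u) ≤ ∑< N h
∑-multiples≤ g h antitone N = ≤-trans (m≤m+n _ _) (invariant N)
  where
  a : ℕ → ℕ
  a u = 𝟙 (suc g ∣? suc u) * h u
  step : ∀ N → suc g * a N + suc N % suc g * h (suc N) ≤ N % suc g * h N + h N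
  step N with suc g ∣? suc N
  ... | yes g∣ = ≤-reflexive (begin-equality
    suc g * (1 * h N) + suc N % suc g * h (suc N)  ≡⟨ cong (λ r → suc g * (1 * h N) + r * h (suc N)) (n∣m⇒m%n≡0 (suc N) (suc g) g∣) ⟩
    suc g * (1 * h N) + 0 * h (suc N)              ≡⟨ simplify g (h N) (h (suc N)) ⟩
    g * h N + h N                                  ≡⟨ cong (λ r → r * h N + h N) (%-pred-≡0 {N} {suc g} (n∣m⇒m%n≡0 (suc N) (suc g) g∣)) ⟨
    N % suc g * h N + h N                          ∎)
    where
    open ≤-Reasoning
    simplify : ∀ g x y → suc g * (1 * x) + 0 * y ≡ g * x + x
    simplify = solve-∀
  ... | no g∤ = begin
    suc g * (0 * h N) + suc N % suc g * h (suc N)  ≡⟨ cong (λ r → suc g * (0 * h N) + r * h (suc N)) ([1+m]%n≡1+[m%n] N (suc g) g∤) ⟩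
    suc g * (0 * h N) + suc r * h (suc N)          ≡⟨ simplify g (h N) r (h (suc N)) ⟩
    r * h (suc N) + h (suc N)                      ≤⟨ +-mono-≤ (*-monoʳ-≤ r (antitone N)) (antitone N) ⟩
    r * h N + h N                                  ∎
    where
    open ≤-Reasoning
    r = N % suc g
    simplify : ∀ g x r y → suc g * (0 * x) + suc r * y ≡ r * y + y
    simplify = solve-∀
  invariant : ∀ N → suc g * ∑< N a + N % suc g * h N ≤ ∑< N h
  invariant zero    = ≤-reflexive (trans (+-identityʳ (g * 0)) (*-zeroʳ g))
  invariant (suc N) = begin
    suc g * ∑< (suc N) a + suc N % suc g * h (suc N)            ≡⟨ cong (λ s → suc g * s + suc N % suc g * h (suc N)) (∑<-last N a) ⟩
    suc g * (∑< N a + a N) + suc N % suc g * h (suc N)          ≡⟨ regroup (suc g) (∑< N a) (a N) (suc N % suc g * h (suc N)) ⟩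
    suc g * ∑< N a + (suc g * a N + suc N % suc g * h (suc N))  ≤⟨ +-monoʳ-≤ (suc g * ∑< N a) (step N) ⟩
    suc g * ∑< N a + (N % suc g * h N + h N)                    ≡⟨ +-assoc (suc g * ∑< N a) _ (h N) ⟨
    suc g * ∑< N a + N % suc g * h N + h N                      ≤⟨ +-monoˡ-≤ (h N) (invariant N) ⟩
    ∑< N h + h N                                                ≡⟨ ∑<-last N h ⟨
    ∑< (suc N) h                                                ∎
    where
    open ≤-Reasoning
    regroup : ∀ c s x y → c * (s + x) + y ≡ c * s + (c * x + y)
    regroup = solve-∀

-- The number of d-tuples of positive multiples of g with sum at most m.
simplex : (g d m : ℕ) → ℕ
simplex g zero    m = 1
simplex g (suc d) m = ∑[ u < m ] 𝟙 (g ∣? suc u) * simplex g d (m ∸ suc u)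

simplex-upper : ∀ g d m → d ! * simplex (suc g) d m * suc g ^ d ≤ m ^ d
simplex-upper g zero    m = ≤-refl
simplex-upper g (suc d) m = begin
  suc d ! * ∑< m T * (G * G ^ d)                           ≡⟨ regroup (suc d) (d !) (∑< m T) G (G ^ d) ⟩
  suc d * ((G * d ! * G ^ d) * ∑< m T)                     ≡⟨ cong (suc d *_) (∑<-*ˡ m (G * d ! * G ^ d) T) ⟨
  suc d * (∑[ u < m ] (G * d ! * G ^ d) * T u)             ≡⟨ cong (suc d *_) (∑<-cong m (λ u _ → regroupᵢ G (d !) (G ^ d) (𝟙u u) (S u))) ⟩
  suc d * (∑[ u < m ] G * (𝟙u u * (d ! * S u * G ^ d)))    ≤⟨ *-monoʳ-≤ (suc d) (∑<-mono m (λ u → *-monoʳ-≤ G (*-monoʳ-≤ (𝟙u u) (simplex-upper g d (m ∸ suc u))))) ⟩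
  suc d * (∑[ u < m ] G * (𝟙u u * h u))                    ≡⟨ cong (suc d *_) (∑<-*ˡ m G (λ u → 𝟙u u * h u)) ⟩
  suc d * (G * (∑[ u < m ] 𝟙u u * h u))                    ≤⟨ *-monoʳ-≤ (suc d) (∑-multiples≤ g h h-antitone m) ⟩
  suc d * ∑< m h                                           ≡⟨ cong (suc d *_) (∑<-reverse m (_^ d)) ⟩
  suc d * ∑< m (_^ d)                                      ≤⟨ [1+d]*∑w^d≤m^[1+d] d m ⟩
  m ^ suc d                                                ∎
  where
  open ≤-Reasoning
  G = suc g
  𝟙u : ℕ → ℕ
  𝟙u u = 𝟙 (G ∣? suc u)
  S : ℕ → ℕ
  S u = simplex G d (m ∸ suc u)
  T : ℕ → ℕ
  T u = 𝟙u u * S u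
  h : ℕ → ℕ
  h u = (m ∸ suc u) ^ d
  h-antitone : ∀ u → h (suc u) ≤ h u
  h-antitone u = ^-monoˡ-≤ d (∸-monoʳ-≤ m (n≤1+n (suc u)))
  regroup : ∀ s f x G p → s * f * x * (G * p) ≡ s * ((G * f * p) * x)
  regroup = solve-∀
  regroupᵢ : ∀ G f p i s → (G * f * p) * (i * s) ≡ G * (i * (f * s * p))
  regroupᵢ = solve-∀

simplex-lower : ∀ d m → (m ∸ d) ^ d ≤ d ! * simplex 1 d m
simplex-lower zero    m = ≤-refl
simplex-lower (suc d) m = begin
  (m ∸ suc d) ^ suc d                                       ≤⟨ [m∸[1+d]]^[1+d]≤[1+d]*∑[w∸d]^d d m ⟩
  suc d * ∑< m F                                            ≡⟨ cong (suc d *_) (∑<-reverse m F) ⟨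
  suc d * (∑[ u < m ] F (m ∸ suc u))                        ≤⟨ *-monoʳ-≤ (suc d) (∑<-mono m (λ u → simplex-lower d (m ∸ suc u))) ⟩
  suc d * (∑[ u < m ] d ! * S u)                            ≡⟨ cong (suc d *_) (∑<-cong m (λ u _ → trans (cong (λ i → d ! * (i * S u)) (𝟙-yes (1 ∣? suc u) (1∣ suc u))) (cong (d ! *_) (*-identityˡ (S u))))) ⟨
  suc d * (∑[ u < m ] d ! * (𝟙 (1 ∣? suc u) * S u))         ≡⟨ cong (suc d *_) (∑<-*ˡ m (d !) (λ u → 𝟙 (1 ∣? suc u) * S u)) ⟩
  suc d * (d ! * simplex 1 (suc d) m)                       ≡⟨ *-assoc (suc d) (d !) _ ⟨
  suc d ! * simplex 1 (suc d) m                             ∎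
  where
  open ≤-Reasoning
  F : ℕ → ℕ
  F w = (w ∸ d) ^ d
  S : ℕ → ℕ
  S u = simplex 1 d (m ∸ suc u)

-- Telescoping: 1/(9+2j)² ≤ (1/(7+2j) − 1/(9+2j))/2, so the sum over j < N is at most N/(7(7+2N)) < 1/14.
odd-square-tail : ∀ P (f : ℕ → ℕ) → (∀ j → f j * ((9 + 2 * j) * (9 + 2 * j)) ≤ P) → ∀ N → 14 * ∑< N f ≤ P
odd-square-tail P f bound N = *-cancelˡ-≤ (7 + 2 * N) (begin
  (7 + 2 * N) * (14 * ∑< N f)   ≡⟨ reassoc (7 + 2 * N) (∑< N f) ⟩
  14 * (7 + 2 * N) * ∑< N f    ≤⟨ telescope N ⟩
  P * (2 * N)                   ≤⟨ *-monoʳ-≤ P (m≤n+m (2 * N) 7) ⟩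
  P * (7 + 2 * N)               ≡⟨ *-comm P _ ⟩
  (7 + 2 * N) * P               ∎)
  where
  open ≤-Reasoning
  reassoc : ∀ L s → L * (14 * s) ≡ 14 * L * s
  reassoc = solve-∀
  telescope : ∀ N → 14 * (7 + 2 * N) * ∑< N f ≤ P * (2 * N)
  telescope zero    = z≤n
  telescope (suc N) = *-cancelˡ-≤ L (begin
    L * (14 * (7 + 2 * suc N) * ∑< (suc N) f)            ≡⟨ cong (λ s → L * (14 * (7 + 2 * suc N) * s)) (∑<-last N f) ⟩
    L * (14 * (7 + 2 * suc N) * (∑< N f + f N))          ≡⟨ expand L N (∑< N f) (f N) ⟩
    (9 + 2 * N) * (14 * L * ∑< N f) + 14 * (L * ((9 + 2 * N) * f N))
                                                         ≤⟨ +-mono-≤ (*-monoʳ-≤ (9 + 2 * N) (telescope N)) (*-monoʳ-≤ 14 last-term) ⟩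
    (9 + 2 * N) * (P * (2 * N)) + 14 * P                 ≡⟨ collect N P ⟩
    L * (P * (2 * suc N))                                ∎)
    where
    L = 7 + 2 * N
    square-comm : ∀ a x → a * (a * x) ≡ x * (a * a)
    square-comm = solve-∀
    last-term : L * ((9 + 2 * N) * f N) ≤ P
    last-term = ≤-trans (*-monoˡ-≤ ((9 + 2 * N) * f N) (m≤n+m L 2))
                        (≤-trans (≤-reflexive (square-comm (9 + 2 * N) (f N))) (bound N))
    expand : ∀ L N s c → L * (14 * (7 + 2 * suc N) * (s + c)) ≡ (9 + 2 * N) * (14 * L * s) + 14 * (L * ((9 + 2 * N) * c))
    expand = solve-∀
    collect : ∀ N P → (9 + 2 * N) * (P * (2 * N)) + 14 * P ≡ (7 + 2 * N) * (P * (2 * suc N))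
    collect = solve-∀

rescale : ∀ k c x P → x * c ≤ P → 1000 ≤ k * c → 1000 * x ≤ k * P
rescale k c x P x*c≤P 1000≤k*c = begin
  1000 * x     ≤⟨ *-monoˡ-≤ x 1000≤k*c ⟩
  k * c * x    ≡⟨ reassoc k c x ⟩
  k * (x * c)  ≤⟨ *-monoʳ-≤ k x*c≤P ⟩
  k * P        ∎
  where
  open ≤-Reasoning
  reassoc : ∀ k c x → k * c * x ≡ k * (x * c)
  reassoc = solve-∀

-- 1/4 + 1/9 + 1/25 + 1/49 + 1/14 < 0.495, the last term bounding the tail by odd-square-tail.
1000*[e+∑f]≤495*P : ∀ P e (f : ℕ → ℕ) → e * 4 ≤ P → (∀ j → f j * ((3 + 2 * j) * (3 + 2 * j)) ≤ P) →
                       ∀ N → 1000 * (e + ∑< N f) ≤ 495 * P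
1000*[e+∑f]≤495*P P e f e*4≤P bound N = begin
  1000 * (e + ∑< N f)                                       ≤⟨ *-monoʳ-≤ 1000 (+-monoʳ-≤ e (∑<-monoˡ f (m≤n+m N 3))) ⟩
  1000 * (e + (f 0 + (f 1 + (f 2 + tail))))                 ≡⟨ distrib 1000 e (f 0) (f 1) (f 2) tail ⟩
  1000 * e + (1000 * f 0 + (1000 * f 1 + (1000 * f 2 + 1000 * tail)))
      ≤⟨ +-mono-≤ (rescale 250 4 e P e*4≤P ≤-refl)
        (+-mono-≤ (rescale 112 9 (f 0) P (bound 0) (m≤m+n 1000 8))
        (+-mono-≤ (rescale 40 25 (f 1) P (bound 1) ≤-refl)
        (+-mono-≤ (rescale 21 49 (f 2) P (bound 2) (m≤m+n 1000 29))
                  (rescale 72 14 tail P (≤-trans (≤-reflexive (*-comm tail 14)) tail-bound) (m≤m+n 1000 8))))) ⟩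
  250 * P + (112 * P + (40 * P + (21 * P + 72 * P)))        ≡⟨ collect P ⟩
  495 * P                                                   ∎
  where
  open ≤-Reasoning
  tail = ∑[ j < N ] f (3 + j)
  shift : ∀ j → 3 + 2 * (3 + j) ≡ 9 + 2 * j
  shift = solve-∀
  tail-bound : 14 * tail ≤ P
  tail-bound = odd-square-tail P (λ j → f (3 + j)) (λ j → subst (λ g → f (3 + j) * (g * g) ≤ P) (shift j) (bound (3 + j))) N
  distrib : ∀ c a b₀ b₁ b₂ t → c * (a + (b₀ + (b₁ + (b₂ + t)))) ≡ c * a + (c * b₀ + (c * b₁ + (c * b₂ + c * t)))
  distrib = solve-∀
  collect : ∀ P → 250 * P + (112 * P + (40 * P + (21 * P + 72 * P))) ≡ 495 * P
  collect = solve-∀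

m*[m∸[a+b]]≤[m∸a]*[m∸b] : ∀ m a b → m * (m ∸ (a + b)) ≤ (m ∸ a) * (m ∸ b)
m*[m∸[a+b]]≤[m∸a]*[m∸b] m a b with a + b ≤? m
... | no  a+b≰m = ≤-trans (≤-reflexive (trans (cong (m *_) (m≤n⇒m∸n≡0 (<⇒≤ (≰⇒> a+b≰m)))) (*-zeroʳ m))) z≤n
... | yes a+b≤m with r , refl ← m≤n⇒∃[o]m+o≡n a+b≤m = begin
  (a + b + r) * (a + b + r ∸ (a + b))         ≡⟨ cong ((a + b + r) *_) (m+n∸m≡n (a + b) r) ⟩
  (a + b + r) * r                             ≤⟨ m≤m+n _ (a * b) ⟩
  (a + b + r) * r + a * b                     ≡⟨ expand a b r ⟩
  (b + r) * (a + r)                           ≡⟨ cong₂ _*_ (m+n∸m≡n a (b + r)) (m+n∸m≡n b (a + r)) ⟨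
  (a + (b + r) ∸ a) * (b + (a + r) ∸ b)      ≡⟨ cong₂ (λ x y → (x ∸ a) * (y ∸ b)) (+-assoc a b r) (reorder a b r) ⟨
  (a + b + r ∸ a) * (a + b + r ∸ b)          ∎
  where
  open ≤-Reasoning
  expand : ∀ a b r → (a + b + r) * r + a * b ≡ (b + r) * (a + r)
  expand = solve-∀
  reorder : ∀ a b r → a + b + r ≡ b + (a + r)
  reorder = solve-∀

[1+m]^d*[m∸d]≤m^d*m : ∀ m d → suc m ^ d * (m ∸ d) ≤ m ^ d * m
[1+m]^d*[m∸d]≤m^d*m m zero    = ≤-refl
[1+m]^d*[m∸d]≤m^d*m m (suc d) = begin
  suc m * suc m ^ d * (m ∸ suc d)      ≡⟨ x*y*z≡y*[x*z] (suc m) (suc m ^ d) (m ∸ suc d) ⟩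
  suc m ^ d * (suc m * (m ∸ suc d))    ≤⟨ *-monoʳ-≤ (suc m ^ d) (m*[m∸[a+b]]≤[m∸a]*[m∸b] (suc m) 1 (suc d)) ⟩
  suc m ^ d * (m * (m ∸ d))            ≡⟨ x*[y*z]≡y*[x*z] (suc m ^ d) m (m ∸ d) ⟩
  m * (suc m ^ d * (m ∸ d))            ≤⟨ *-monoʳ-≤ m ([1+m]^d*[m∸d]≤m^d*m m d) ⟩
  m * (m ^ d * m)                      ≡⟨ *-assoc m (m ^ d) m ⟨
  m * m ^ d * m                        ∎
  where open ≤-Reasoning

m^k*[m∸a*k]≤[m∸a]^k*m : ∀ m a k → m ^ k * (m ∸ a * k) ≤ (m ∸ a) ^ k * m
m^k*[m∸a*k]≤[m∸a]^k*m m a zero    = ≤-reflexive (cong (λ x → 1 * (m ∸ x)) (*-zeroʳ a))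
m^k*[m∸a*k]≤[m∸a]^k*m m a (suc k) = begin
  m * m ^ k * (m ∸ a * suc k)           ≡⟨ cong (λ x → m * m ^ k * (m ∸ x)) (*-suc a k) ⟩
  m * m ^ k * (m ∸ (a + a * k))         ≡⟨ x*y*z≡y*[x*z] m (m ^ k) _ ⟩
  m ^ k * (m * (m ∸ (a + a * k)))       ≤⟨ *-monoʳ-≤ (m ^ k) (m*[m∸[a+b]]≤[m∸a]*[m∸b] m a (a * k)) ⟩
  m ^ k * ((m ∸ a) * (m ∸ a * k))       ≡⟨ x*[y*z]≡y*[x*z] (m ^ k) (m ∸ a) _ ⟩
  (m ∸ a) * (m ^ k * (m ∸ a * k))       ≤⟨ *-monoʳ-≤ (m ∸ a) (m^k*[m∸a*k]≤[m∸a]^k*m m a k) ⟩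
  (m ∸ a) * ((m ∸ a) ^ k * m)           ≡⟨ *-assoc (m ∸ a) _ m ⟨
  (m ∸ a) * (m ∸ a) ^ k * m             ∎
  where open ≤-Reasoning

1990*[e+r]²≤2000*r² : ∀ e r → 1000 * e ≤ r → 1990 * ((e + r) * (e + r)) ≤ 2000 * (r * r)
1990*[e+r]²≤2000*r² e r 1000e≤r = begin
  1990 * ((e + r) * (e + r))                        ≡⟨ expand e r ⟩
  1990 * (e * e) + 3980 * (e * r) + 1990 * (r * r)  ≤⟨ +-monoˡ-≤ _ (+-monoˡ-≤ _ (*-monoʳ-≤ 1990 (*-monoʳ-≤ e e≤r))) ⟩
  1990 * (e * r) + 3980 * (e * r) + 1990 * (r * r)  ≡⟨ collect e r ⟩
  5970 * (e * r) + 1990 * (r * r)                   ≤⟨ +-monoˡ-≤ _ (*-monoˡ-≤ (e * r) (m≤m+n 5970 4030)) ⟩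
  10000 * (e * r) + 1990 * (r * r)                  ≡⟨ cong (_+ 1990 * (r * r)) (reassoc e r) ⟩
  10 * ((1000 * e) * r) + 1990 * (r * r)            ≤⟨ +-monoˡ-≤ _ (*-monoʳ-≤ 10 (*-monoˡ-≤ r 1000e≤r)) ⟩
  10 * (r * r) + 1990 * (r * r)                     ≡⟨ *-distribʳ-+ (r * r) 10 1990 ⟨
  2000 * (r * r)                                    ∎
  where
  open ≤-Reasoning
  e≤r : e ≤ r
  e≤r = ≤-trans (m≤n*m e 1000) 1000e≤r
  expand : ∀ e r → 1990 * ((e + r) * (e + r)) ≡ 1990 * (e * e) + 3980 * (e * r) + 1990 * (r * r)
  expand = solve-∀
  collect : ∀ e r → 1990 * (e * r) + 3980 * (e * r) + 1990 * (r * r) ≡ 5970 * (e * r) + 1990 * (r * r)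
  collect = solve-∀
  reassoc : ∀ e r → 10000 * (e * r) ≡ 10 * ((1000 * e) * r)
  reassoc = solve-∀

-- (1+m)^d ≤ m^d·m/(m−d) and (m−d)^d ≥ m^d·(m−d²)/m, and m−d² ≥ (1000/1001)·m.
1000*[1+m]^d+990*m^d≤2000*[m∸d]^d : ∀ d m → 1001 * (d * d) < m → 1000 * suc m ^ d + 990 * m ^ d ≤ 2000 * (m ∸ d) ^ d
1000*[1+m]^d+990*m^d≤2000*[m∸d]^d d m large = *-cancelʳ-≤ _ _ (m * X) {{>-nonZero (*-mono-< 0<m 0<X)}} (begin
  (1000 * B + 990 * P) * (m * X)       ≡⟨ distribute 1000 990 B P m X ⟩
  1000 * (B * X) * m + 990 * P * m * X ≤⟨ +-mono-≤ (*-monoˡ-≤ m (*-monoʳ-≤ 1000 ([1+m]^d*[m∸d]≤m^d*m m d))) (*-monoʳ-≤ (990 * P * m) X≤m) ⟩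
  1000 * (P * m) * m + 990 * P * m * m ≡⟨ collect 1000 990 P m ⟩
  P * (1990 * (m * m))                 ≤⟨ *-monoʳ-≤ P (subst (λ x → 1990 * (x * x) ≤ 2000 * (Y * Y)) e+Y≡m (1990*[e+r]²≤2000*r² e Y 1000e≤Y)) ⟩
  P * (2000 * (Y * Y))                 ≡⟨ regroup 2000 P Y ⟩
  2000 * (P * Y) * Y                   ≤⟨ *-mono-≤ (*-monoʳ-≤ 2000 (m^k*[m∸a*k]≤[m∸a]^k*m m d d)) Y≤X ⟩
  2000 * (A * m) * X                   ≡⟨ reassoc 2000 A m X ⟩
  (2000 * A) * (m * X)                 ∎)
  where
  open ≤-Reasoning
  e = d * d
  X = m ∸ d
  Y = m ∸ e
  A = X ^ d
  B = suc m ^ d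
  P = m ^ d
  d≤d*d : ∀ d → d ≤ d * d
  d≤d*d zero    = z≤n
  d≤d*d (suc d) = m≤m+n (suc d) _
  d≤e : d ≤ e
  d≤e = d≤d*d d
  e≤1001e : e ≤ 1001 * e
  e≤1001e = m≤n*m e 1001
  d<m : d < m
  d<m = ≤-<-trans (≤-trans d≤e e≤1001e) large
  0<m : 0 < m
  0<m = ≤-<-trans z≤n d<m
  0<X : 0 < X
  0<X = m<n⇒0<n∸m d<m
  Y≤X : Y ≤ X
  Y≤X = ∸-monoʳ-≤ m d≤e
  X≤m : X ≤ m
  X≤m = m∸n≤m m d
  e+Y≡m : e + Y ≡ m
  e+Y≡m = m+[n∸m]≡n (≤-trans e≤1001e (<⇒≤ large))
  1000e≤Y : 1000 * e ≤ Y
  1000e≤Y = +-cancelˡ-≤ e (1000 * e) Y (≤-trans (<⇒≤ large) (≤-reflexive (sym e+Y≡m)))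
  distribute : ∀ a b B P m X → (a * B + b * P) * (m * X) ≡ a * (B * X) * m + b * P * m * X
  distribute = solve-∀
  collect : ∀ a b P m → a * (P * m) * m + b * P * m * m ≡ P * ((a + b) * (m * m))
  collect = solve-∀
  regroup : ∀ c P Y → P * (c * (Y * Y)) ≡ c * (P * Y) * Y
  regroup = solve-∀
  reassoc : ∀ c A m X → c * (A * m) * X ≡ (c * A) * (m * X)
  reassoc = solve-∀

-- Zero-sum-free vectors of ℤₙ^d

even-or-odd : ∀ k → (∃[ a ] k ≡ 2 * a) ⊎ (∃[ a ] k ≡ 1 + 2 * a)
even-or-odd zero    = inj₁ (0 , refl)
even-or-odd (suc k) with even-or-odd k
... | inj₁ (a , refl) = inj₂ (a , refl)
... | inj₂ (a , refl) = inj₁ (suc a , 2+2a≡2[1+a] a)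
  where
  2+2a≡2[1+a] : ∀ a → 2 + 2 * a ≡ 2 * (1 + a)
  2+2a≡2[1+a] = solve-∀

module _ (n : ℕ) where

  neg : Fin n → ℕ
  neg i = n ∸ toℕ i

  Fits : (g m v : ℕ) → Set
  Fits g m v = 1 ≤ v × v ≤ m × g ∣ v

  fits? : ∀ g m v → Dec (Fits g m v)
  fits? g m v = 1 ≤? v ×-dec v ≤? m ×-dec g ∣? v

  InSimplex : ∀ {d} → (Fin n → ℕ) → (g m : ℕ) → Vec (Fin n) d → Set
  InSimplex t g m []      = ⊤
  InSimplex t g m (i ∷ x) = Fits g m (t i) × InSimplex t g (m ∸ t i) x

  inSimplex? : ∀ {d} t g m (x : Vec (Fin n) d) → Dec (InSimplex t g m x)
  inSimplex? t g m []      = yes tt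
  inSimplex? t g m (i ∷ x) = fits? g m (t i) ×-dec inSimplex? t g (m ∸ t i) x

  Reindexes : (Fin n → ℕ) → Set
  Reindexes t = ∀ {m} → m < n → (G : ℕ → ℕ) → G 0 ≡ 0 → (∀ v → m < v → G v ≡ 0) →
                ∑[ i ∈ allFin n ] G (t i) ≡ ∑[ u < m ] G (suc u)

  toℕ-reindexes : Reindexes toℕ
  toℕ-reindexes {m} m<n G G0≡0 vanish = begin
    ∑∈ (G ∘ toℕ) (allFin n)  ≡⟨ ∑∈-tabulate {k = n} (λ i → i) (G ∘ toℕ) G (λ _ → refl) ⟩
    ∑< n G                   ≡⟨ ∑<-cut G m<n vanish ⟩
    G 0 + ∑< m (G ∘ suc)     ≡⟨ cong (_+ ∑< m (G ∘ suc)) G0≡0 ⟩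
    ∑< m (G ∘ suc)           ∎
    where open ≡-Reasoning

  neg-reindexes : Reindexes neg
  neg-reindexes {m} m<n G G0≡0 vanish = begin
    ∑∈ (G ∘ neg) (allFin n)                  ≡⟨ ∑∈-tabulate {k = n} (λ i → i) (G ∘ neg) (λ v → G (suc (n ∸ suc v))) (λ i → cong G (+-∸-assoc 1 (toℕ<n i))) ⟩
    ∑[ v < n ] G (suc (n ∸ suc v))           ≡⟨ ∑<-reverse n (G ∘ suc) ⟩
    ∑< n (G ∘ suc)                           ≡⟨ ∑<-cut (G ∘ suc) (<⇒≤ m<n) (λ v m≤v → vanish (suc v) (s≤s m≤v)) ⟩
    ∑< m (G ∘ suc)                           ∎
    where open ≡-Reasoning

  ∑-allVecs-suc : ∀ d (w : Vec (Fin n) (suc d) → ℕ) →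
                  ∑∈ w (allVecs (suc d) n) ≡ ∑[ i ∈ allFin n ] ∑[ x ∈ allVecs d n ] w (i ∷ x)
  ∑-allVecs-suc d w = trans (∑∈-concatMap w _ (allFin n)) (∑∈-cong (allFin n) (λ i → ∑∈-map w (i ∷_) (allVecs d n)))

  ∑-inSimplex : ∀ {t} → Reindexes t → ∀ g d {m} → m < n → ∑[ x ∈ allVecs d n ] 𝟙 (inSimplex? t g m x) ≡ simplex g d m
  ∑-inSimplex {t} reindexes g zero    m<n = refl
  ∑-inSimplex {t} reindexes g (suc d) {m} m<n = begin
    ∑[ x ∈ allVecs (suc d) n ] 𝟙 (inSimplex? t g m x)
      ≡⟨ ∑-allVecs-suc d (λ x → 𝟙 (inSimplex? t g m x)) ⟩
    ∑[ i ∈ allFin n ] ∑[ x ∈ allVecs d n ] 𝟙 (fits? g m (t i) ×-dec inSimplex? t g (m ∸ t i) x)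
      ≡⟨ ∑∈-cong (allFin n) (λ i → trans (∑∈-cong (allVecs d n) (λ x → 𝟙-× (fits? g m (t i)) _))
                                        (∑∈-*ˡ (𝟙 (fits? g m (t i))) _ (allVecs d n))) ⟩
    ∑[ i ∈ allFin n ] 𝟙 (fits? g m (t i)) * (∑[ x ∈ allVecs d n ] 𝟙 (inSimplex? t g (m ∸ t i) x))
      ≡⟨ ∑∈-cong (allFin n) (λ i → cong (𝟙 (fits? g m (t i)) *_) (∑-inSimplex reindexes g d (≤-<-trans (m∸n≤m m (t i)) m<n))) ⟩
    ∑[ i ∈ allFin n ] G (t i)
      ≡⟨ reindexes m<n G G0≡0 G-vanishes ⟩
    ∑[ u < m ] G (suc u)
      ≡⟨ ∑<-cong m G[1+u]≡ ⟩
    simplex g (suc d) m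
      ∎
    where
    open ≡-Reasoning
    G : ℕ → ℕ
    G v = 𝟙 (fits? g m v) * simplex g d (m ∸ v)
    G0≡0 : G 0 ≡ 0
    G0≡0 = cong (_* simplex g d m) (𝟙-no (fits? g m 0) λ ())
    G-vanishes : ∀ v → m < v → G v ≡ 0
    G-vanishes v m<v = cong (_* simplex g d (m ∸ v)) (𝟙-no (fits? g m v) (λ (_ , v≤m , _) → <⇒≱ m<v v≤m))
    G[1+u]≡ : ∀ u → u < m → G (suc u) ≡ 𝟙 (g ∣? suc u) * simplex g d (m ∸ suc u)
    G[1+u]≡ u u<m = cong (_* simplex g d (m ∸ suc u))
                         (𝟙-cong (fits? g m (suc u)) (g ∣? suc u) (λ (_ , _ , g∣) → g∣) (λ g∣ → s≤s z≤n , u<m , g∣))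

  sumBy : ∀ {d} → (Fin n → ℕ) → Subset d → Vec (Fin n) d → ℕ
  sumBy t []            []      = 0
  sumBy t (inside ∷ s)  (i ∷ x) = t i + sumBy t s x
  sumBy t (outside ∷ s) (i ∷ x) = sumBy t s x

  subsetSum≡sumBy-toℕ : ∀ {d} (s : Subset d) (x : Vec (Fin n) d) → subsetSum s x ≡ sumBy toℕ s x
  subsetSum≡sumBy-toℕ []            []      = refl
  subsetSum≡sumBy-toℕ (inside ∷ s)  (i ∷ x) = cong (toℕ i +_) (subsetSum≡sumBy-toℕ s x)
  subsetSum≡sumBy-toℕ (outside ∷ s) (i ∷ x) = subsetSum≡sumBy-toℕ s x

  sumBy-toℕ+sumBy-neg : ∀ {d} (s : Subset d) (x : Vec (Fin n) d) → sumBy toℕ s x + sumBy neg s x ≡ ∣ s ∣ * n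
  sumBy-toℕ+sumBy-neg []            []      = refl
  sumBy-toℕ+sumBy-neg (outside ∷ s) (i ∷ x) = sumBy-toℕ+sumBy-neg s x
  sumBy-toℕ+sumBy-neg (inside ∷ s)  (i ∷ x) = begin
    toℕ i + sumBy toℕ s x + (neg i + sumBy neg s x)      ≡⟨ +-interchange (toℕ i) _ (neg i) _ ⟩
    (toℕ i + neg i) + (sumBy toℕ s x + sumBy neg s x)    ≡⟨ cong₂ _+_ (m+[n∸m]≡n (<⇒≤ (toℕ<n i))) (sumBy-toℕ+sumBy-neg s x) ⟩
    n + ∣ s ∣ * n                                        ∎
    where open ≡-Reasoning

  sumBy≤ : ∀ {d t g m} (s : Subset d) (x : Vec (Fin n) d) → InSimplex t g m x → sumBy t s x ≤ m
  sumBy≤                 []            []      _                    = z≤n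
  sumBy≤ {t = t} {m = m} (inside ∷ s)  (i ∷ x) ((_ , ti≤m , _) , x∈) = begin
    t i + sumBy t s x   ≤⟨ +-monoʳ-≤ (t i) (sumBy≤ s x x∈) ⟩
    t i + (m ∸ t i)     ≡⟨ m+[n∸m]≡n ti≤m ⟩
    m                   ∎
    where open ≤-Reasoning
  sumBy≤ {t = t} {m = m} (outside ∷ s) (i ∷ x) (_ , x∈)             = ≤-trans (sumBy≤ s x x∈) (m∸n≤m m (t i))

  0<sumBy : ∀ {d t g m} (s : Subset d) (x : Vec (Fin n) d) → InSimplex t g m x → Nonempty s → 0 < sumBy t s x
  0<sumBy {t = t} (inside ∷ s)  (i ∷ x) ((1≤ti , _) , _) _ = ≤-trans 1≤ti (m≤m+n (t i) _)
  0<sumBy         (outside ∷ s) (i ∷ x) (_ , x∈) (suc j , j∈) = 0<sumBy s x x∈ (j , drop-there j∈)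

  DetectsZeroSums : (Fin n → ℕ) → Set
  DetectsZeroSums t = ∀ {d} (s : Subset d) (x : Vec (Fin n) d) → n ∣ subsetSum s x → n ∣ sumBy t s x

  toℕ-detectsZeroSums : DetectsZeroSums toℕ
  toℕ-detectsZeroSums s x = subst (n ∣_) (subsetSum≡sumBy-toℕ s x)

  neg-detectsZeroSums : DetectsZeroSums neg
  neg-detectsZeroSums s x n∣ = ∣m+n∣m⇒∣n (subst (n ∣_) (sym (sumBy-toℕ+sumBy-neg s x)) (n∣m*n ∣ s ∣))
                                          (toℕ-detectsZeroSums s x n∣)

  inSimplex⇒zeroSumFree : ∀ {d t g m} → DetectsZeroSums t → m < n → (x : Vec (Fin n) d) →
                          InSimplex t g m x → ZeroSumFree n x
  inSimplex⇒zeroSumFree detects m<n x x∈ s nonempty n∣ =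
    <⇒≱ (≤-<-trans (sumBy≤ s x x∈) m<n) (∣⇒≤ {{>-nonZero (0<sumBy s x x∈ nonempty)}} (detects s x n∣))

  -- With d ≥ 2 the two sums over all coordinates add up to d·n ≥ 2n, but each is below n.
  simplices-disjoint : ∀ {d g g′ m} → 2 ≤ d → m < n → (x : Vec (Fin n) d) →
                       InSimplex toℕ g m x → InSimplex neg g′ m x → ⊥
  simplices-disjoint {d} {m = m} 2≤d m<n x x∈ x∈′ = <⇒≱ (+-mono-< (below-n x∈) (below-n x∈′)) (begin
    n + n                                        ≡⟨ cong (n +_) (+-identityʳ n) ⟨
    2 * n                                        ≤⟨ *-monoˡ-≤ n 2≤d ⟩
    d * n                                        ≡⟨ cong (_* n) (∣⊤∣≡n d) ⟨
    ∣ Subset.⊤ {d} ∣ * n                         ≡⟨ sumBy-toℕ+sumBy-neg Subset.⊤ x ⟨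
    sumBy toℕ Subset.⊤ x + sumBy neg Subset.⊤ x  ∎)
    where
    open ≤-Reasoning
    below-n : ∀ {t g} → InSimplex t g m x → sumBy t Subset.⊤ x < n
    below-n x∈ = ≤-<-trans (sumBy≤ Subset.⊤ x x∈) m<n

  gcdWith : ∀ {d} → Vec (Fin n) d → ℕ
  gcdWith x = foldr (λ _ → ℕ) (λ i g → gcd (toℕ i) g) n x

  gcdWith∣n : ∀ {d} (x : Vec (Fin n) d) → gcdWith x ∣ n
  gcdWith∣n []      = ∣-refl
  gcdWith∣n (i ∷ x) = ∣-trans (gcd[m,n]∣n (toℕ i) (gcdWith x)) (gcdWith∣n x)

  gcdWith∣coordinates : ∀ {d} (x : Vec (Fin n) d) → All (λ i → gcdWith x ∣ toℕ i) x
  gcdWith∣coordinates []      = []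
  gcdWith∣coordinates (i ∷ x) = gcd[m,n]∣m (toℕ i) (gcdWith x)
                              ∷ All.map (∣-trans (gcd[m,n]∣n (toℕ i) (gcdWith x))) (gcdWith∣coordinates x)

  PreservesDivisors : (Fin n → ℕ) → Set
  PreservesDivisors t = ∀ {g} i → g ∣ n → g ∣ toℕ i → g ∣ t i

  toℕ-preservesDivisors : PreservesDivisors toℕ
  toℕ-preservesDivisors i _ g∣i = g∣i

  neg-preservesDivisors : PreservesDivisors neg
  neg-preservesDivisors i g∣n g∣i = ∣m+n∣m⇒∣n (subst (_ ∣_) (sym (m+[n∸m]≡n (<⇒≤ (toℕ<n i)))) g∣n) g∣i

  inSimplex-divisor : ∀ {d t g m} → PreservesDivisors t → g ∣ n → (x : Vec (Fin n) d) →
                      All (λ i → g ∣ toℕ i) x → InSimplex t 1 m x → InSimplex t g m x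
  inSimplex-divisor preserves g∣n []      []            _                        = tt
  inSimplex-divisor preserves g∣n (i ∷ x) (g∣i ∷ g∣x) ((1≤ti , ti≤m , _) , x∈) =
    (1≤ti , ti≤m , preserves i g∣n g∣i) , inSimplex-divisor preserves g∣n x g∣x x∈

  oddCount : ∀ {d} → (Fin n → ℕ) → ℕ → Vec (Fin n) d → ℕ → ℕ
  oddCount t m x j = 𝟙 (inSimplex? t (3 + 2 * j) m x)

  coarseCount : ∀ {d} → (Fin n → ℕ) → ℕ → Vec (Fin n) d → ℕ
  coarseCount t m x = 𝟙 (inSimplex? t 2 m x) + ∑< n (oddCount t m x)

  coprime-or-coarse : ∀ {d t m} .{{_ : NonZero n}} → PreservesDivisors t → (x : Vec (Fin n) d) → InSimplex t 1 m x →
                      GcdOne n x ⊎ InSimplex t 2 m x ⊎ ∃[ j ] (j < n × InSimplex t (3 + 2 * j) m x)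
  coprime-or-coarse preserves x x∈ with even-or-odd (gcdWith x) | gcdWith∣n x | gcdWith∣coordinates x
  ... | inj₁ (a , g≡2a)            | g∣n | g∣x = inj₂ (inj₁ (inSimplex-divisor preserves (∣-trans 2∣g g∣n) x (All.map (∣-trans 2∣g) g∣x) x∈))
    where
    2∣g : 2 ∣ gcdWith x
    2∣g = subst (2 ∣_) (sym g≡2a) (m∣m*n a)
  ... | inj₂ (zero , g≡1)          | _   | _   = inj₁ g≡1
  ... | inj₂ (suc j , g≡1+2[1+j]) | g∣n | g∣x = inj₂ (inj₂ (j , j<n , inSimplex-divisor preserves g′∣n x g′∣x x∈))
    where
    1+2[1+j]≡3+2j : ∀ j → 1 + 2 * (1 + j) ≡ 3 + 2 * j
    1+2[1+j]≡3+2j = solve-∀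
    g≡3+2j : gcdWith x ≡ 3 + 2 * j
    g≡3+2j = trans g≡1+2[1+j] (1+2[1+j]≡3+2j j)
    g′∣n : 3 + 2 * j ∣ n
    g′∣n = subst (_∣ n) g≡3+2j g∣n
    g′∣x : All (λ i → 3 + 2 * j ∣ toℕ i) x
    g′∣x = subst (λ g → All (λ i → g ∣ toℕ i) x) g≡3+2j g∣x
    j<3+2j : j < 3 + 2 * j
    j<3+2j = s≤s (≤-trans (m≤m+n j (j + 0)) (m≤n+m _ 2))
    j<n : j < n
    j<n = <-≤-trans j<3+2j (∣⇒≤ g′∣n)

  1≤coarseCount : ∀ {d t m} (x : Vec (Fin n) d) → InSimplex t 2 m x ⊎ ∃[ j ] (j < n × InSimplex t (3 + 2 * j) m x) →
                  1 ≤ coarseCount t m x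
  1≤coarseCount {t = t} {m} x (inj₁ x∈₂)             = ≤-trans (1≤𝟙 (inSimplex? t 2 m x) x∈₂) (m≤m+n _ _)
  1≤coarseCount {t = t} {m} x (inj₂ (j , j<n , x∈ⱼ)) = ≤-trans (1≤𝟙 (inSimplex? t (3 + 2 * j) m x) x∈ⱼ)
                                                         (≤-trans (f≤∑< n (oddCount t m x) j<n) (m≤n+m _ _))

  𝟙-inSimplex-split : ∀ {d t m} .{{_ : NonZero n}} → PreservesDivisors t → (x : Vec (Fin n) d) →
                      𝟙 (inSimplex? t 1 m x) ≤ 𝟙 (gcdOne? n x ×-dec inSimplex? t 1 m x) + coarseCount t m x
  𝟙-inSimplex-split {t = t} {m} preserves x with inSimplex? t 1 m x
  ... | no _   = z≤n
  ... | yes x∈ with coprime-or-coarse preserves x x∈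
  ...   | inj₁ coprime = ≤-trans (1≤𝟙 (gcdOne? n x ×-dec yes x∈) (coprime , x∈)) (m≤m+n _ (coarseCount t m x))
  ...   | inj₂ coarse  = ≤-trans (1≤coarseCount x coarse) (m≤n+m _ (𝟙 (gcdOne? n x ×-dec yes x∈)))

  coarseSimplices : ℕ → ℕ → ℕ
  coarseSimplices d m = simplex 2 d m + (∑[ j < n ] simplex (3 + 2 * j) d m)

  ∑-coarseCount : ∀ {t} → Reindexes t → ∀ d {m} → m < n →
                  ∑[ x ∈ allVecs d n ] coarseCount t m x ≡ coarseSimplices d m
  ∑-coarseCount {t} reindexes d {m} m<n = trans (∑∈-+ (λ x → 𝟙 (inSimplex? t 2 m x)) _ (allVecs d n))
    (cong₂ _+_ (∑-inSimplex reindexes 2 d m<n)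
               (trans (∑∈-∑< n (λ j x → oddCount t m x j) (allVecs d n))
                      (∑<-cong n (λ j _ → ∑-inSimplex reindexes (3 + 2 * j) d m<n))))

  coprimeInSimplex : (Fin n → ℕ) → (d m : ℕ) → ℕ
  coprimeInSimplex t d m = ∑[ x ∈ allVecs d n ] 𝟙 (gcdOne? n x ×-dec inSimplex? t 1 m x)

  simplex≤coprime+coarse : ∀ {t} → Reindexes t → PreservesDivisors t → ∀ d {m} → m < n →
                           simplex 1 d m ≤ coprimeInSimplex t d m + coarseSimplices d m
  simplex≤coprime+coarse {t} reindexes preserves d {m} m<n = begin
    simplex 1 d m
      ≡⟨ ∑-inSimplex reindexes 1 d m<n ⟨
    ∑[ x ∈ allVecs d n ] 𝟙 (inSimplex? t 1 m x)
      ≤⟨ ∑∈-mono (allVecs d n) (𝟙-inSimplex-split preserves) ⟩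
    ∑[ x ∈ allVecs d n ] (𝟙 (gcdOne? n x ×-dec inSimplex? t 1 m x) + coarseCount t m x)
      ≡⟨ ∑∈-+ _ (coarseCount t m) (allVecs d n) ⟩
    coprimeInSimplex t d m + (∑[ x ∈ allVecs d n ] coarseCount t m x)
      ≡⟨ cong (coprimeInSimplex t d m +_) (∑-coarseCount reindexes d m<n) ⟩
    coprimeInSimplex t d m + coarseSimplices d m
      ∎
    where
    open ≤-Reasoning
    instance
      n≢0 : NonZero n
      n≢0 = >-nonZero (≤-<-trans z≤n m<n)

  coprimeInSimplices≤β : ∀ d {m} → 2 ≤ d → m < n → coprimeInSimplex toℕ d m + coprimeInSimplex neg d m ≤ β n d
  coprimeInSimplices≤β d {m} 2≤d m<n = begin
    coprimeInSimplex toℕ d m + coprimeInSimplex neg d m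
      ≡⟨ ∑∈-+ (λ x → 𝟙 (gcdOne? n x ×-dec inSimplex? toℕ 1 m x)) _ (allVecs d n) ⟨
    ∑[ x ∈ allVecs d n ] (𝟙 (gcdOne? n x ×-dec inSimplex? toℕ 1 m x) + 𝟙 (gcdOne? n x ×-dec inSimplex? neg 1 m x))
      ≤⟨ ∑∈-mono (allVecs d n) (λ x → 𝟙-disjoint (gcdOne? n x ×-dec inSimplex? toℕ 1 m x) (gcdOne? n x ×-dec inSimplex? neg 1 m x)
                                                 (zeroSumFree? n x ×-dec gcdOne? n x)
                                                 (λ (coprime , x∈) → inSimplex⇒zeroSumFree toℕ-detectsZeroSums m<n x x∈ , coprime)
                                                 (λ (coprime , x∈) → inSimplex⇒zeroSumFree neg-detectsZeroSums m<n x x∈ , coprime)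
                                                 (λ (_ , x∈) (_ , x∈′) → simplices-disjoint 2≤d m<n x x∈ x∈′)) ⟩
    ∑[ x ∈ allVecs d n ] 𝟙 (zeroSumFree? n x ×-dec gcdOne? n x)
      ≡⟨ length-filter (λ x → zeroSumFree? n x ×-dec gcdOne? n x) (allVecs d n) ⟨
    β n d
      ∎
    where open ≤-Reasoning

  2*simplex≤β+2*coarse : ∀ d {m} → 2 ≤ d → m < n →
                         simplex 1 d m + simplex 1 d m ≤ β n d + (coarseSimplices d m + coarseSimplices d m)
  2*simplex≤β+2*coarse d {m} 2≤d m<n = begin
    simplex 1 d m + simplex 1 d m                ≤⟨ +-mono-≤ (simplex≤coprime+coarse toℕ-reindexes toℕ-preservesDivisors d m<n)
                                                              (simplex≤coprime+coarse neg-reindexes neg-preservesDivisors d m<n) ⟩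
    (A + C) + (A′ + C)                           ≡⟨ +-interchange A C A′ C ⟩
    (A + A′) + (C + C)                           ≤⟨ +-monoˡ-≤ (C + C) (coprimeInSimplices≤β d 2≤d m<n) ⟩
    β n d + (C + C)                              ∎
    where
    open ≤-Reasoning
    A = coprimeInSimplex toℕ d m
    A′ = coprimeInSimplex neg d m
    C = coarseSimplices d m

m*m≤m^n : ∀ m n .{{_ : NonZero m}} → 2 ≤ n → m * m ≤ m ^ n
m*m≤m^n m n 2≤n = ≤-trans (≤-reflexive (cong (m *_) (sym (*-identityʳ m)))) (^-monoʳ-≤ m 2≤n)

1000*d!*coarse≤495*m^d : ∀ d m → 2 ≤ d → 1000 * (d ! * coarseSimplices (suc m) d m) ≤ 495 * m ^ d
1000*d!*coarse≤495*m^d d m 2≤d = begin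
  1000 * (d ! * coarseSimplices (suc m) d m)                    ≡⟨ cong (1000 *_) (*-distribˡ-+ (d !) (simplex 2 d m) (∑< (suc m) oddSimplex)) ⟩
  1000 * (d ! * simplex 2 d m + d ! * ∑< (suc m) oddSimplex)    ≡⟨ cong (λ s → 1000 * (d ! * simplex 2 d m + s)) (∑<-*ˡ (suc m) (d !) oddSimplex) ⟨
  1000 * (d ! * simplex 2 d m + (∑[ j < suc m ] d ! * oddSimplex j))
                                                                 ≤⟨ 1000*[e+∑f]≤495*P (m ^ d) (d ! * simplex 2 d m) (λ j → d ! * oddSimplex j) even-weight odd-weight (suc m) ⟩
  495 * m ^ d                                                    ∎
  where
  open ≤-Reasoning
  oddSimplex : ℕ → ℕ
  oddSimplex j = simplex (3 + 2 * j) d m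
  even-weight : d ! * simplex 2 d m * 4 ≤ m ^ d
  even-weight = ≤-trans (*-monoʳ-≤ (d ! * simplex 2 d m) (m*m≤m^n 2 d 2≤d)) (simplex-upper 1 d m)
  odd-weight : ∀ j → d ! * oddSimplex j * ((3 + 2 * j) * (3 + 2 * j)) ≤ m ^ d
  odd-weight j = ≤-trans (*-monoʳ-≤ (d ! * oddSimplex j) (m*m≤m^n (3 + 2 * j) d 2≤d)) (simplex-upper (2 + 2 * j) d m)

[1+m]^d≤d!*β : ∀ d m → 2 ≤ d → 1001 * (d * d) < m → suc m ^ d ≤ d ! * β (suc m) d
[1+m]^d≤d!*β d m 2≤d large = *-cancelˡ-≤ 1000 (+-cancelʳ-≤ (990 * P) _ _ (begin
  1000 * suc m ^ d + 990 * P                      ≤⟨ 1000*[1+m]^d+990*m^d≤2000*[m∸d]^d d m large ⟩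
  2000 * (m ∸ d) ^ d                              ≤⟨ *-monoʳ-≤ 2000 (simplex-lower d m) ⟩
  2000 * (d ! * K)                                ≡⟨ double 1000 (d !) K ⟩
  1000 * (d ! * (K + K))                          ≤⟨ *-monoʳ-≤ 1000 (*-monoʳ-≤ (d !) (2*simplex≤β+2*coarse (suc m) d 2≤d ≤-refl)) ⟩
  1000 * (d ! * (β (suc m) d + (C + C)))          ≡⟨ distribute 1000 (d !) (β (suc m) d) C ⟩
  1000 * (d ! * β (suc m) d) + (1000 * (d ! * C) + 1000 * (d ! * C))
                                                  ≤⟨ +-monoʳ-≤ (1000 * (d ! * β (suc m) d)) (+-mono-≤ coarse-bound coarse-bound) ⟩
  1000 * (d ! * β (suc m) d) + (495 * P + 495 * P) ≡⟨ cong (1000 * (d ! * β (suc m) d) +_) (*-distribʳ-+ P 495 495) ⟨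
  1000 * (d ! * β (suc m) d) + 990 * P            ∎))
  where
  open ≤-Reasoning
  P = m ^ d
  K = simplex 1 d m
  C = coarseSimplices (suc m) d m
  coarse-bound : 1000 * (d ! * C) ≤ 495 * P
  coarse-bound = 1000*d!*coarse≤495*m^d d m 2≤d
  double : ∀ c D K → 2 * c * (D * K) ≡ c * (D * (K + K))
  double = solve-∀
  distribute : ∀ c D b C → c * (D * (b + (C + C))) ≡ c * (D * b) + (c * (D * C) + c * (D * C))
  distribute = solve-∀

toℚ≡mkℚ : ∀ k → toℚ k ≡ mkℚ (ℤ.+ k) 0 (Coprime.sym (1-coprimeTo k))
toℚ≡mkℚ k = ℚP.normalize-coprime (Coprime.sym (1-coprimeTo k))

toℚ-mono-≤ : ∀ {a b} → a ≤ b → toℚ a ℚ.≤ toℚ b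
toℚ-mono-≤ {a} {b} a≤b rewrite toℚ≡mkℚ a | toℚ≡mkℚ b =
  ℚ.*≤* (subst₂ ℤ._≤_ (sym (ℤP.*-identityʳ (ℤ.+ a))) (sym (ℤP.*-identityʳ (ℤ.+ b))) (ℤ.+≤+ a≤b))

toℚ-* : ∀ a b → toℚ (a * b) ≡ toℚ a ℚ.* toℚ b
toℚ-* a b rewrite toℚ≡mkℚ a | toℚ≡mkℚ b = cong (ℚ._/ 1) (ℤP.pos-* a b)

ζPartial-1 : ∀ d → ζPartial d 1 ≡ 1ℚ
ζPartial-1 d = cong (0ℚ ℚ.+_) (1/k≡1 (^-zeroˡ d) {{m^n≢0 1 d}})
  where
  1/k≡1 : ∀ {k} → k ≡ 1 → .{{_ : NonZero k}} → ℤ.+ 1 ℚ./ k ≡ 1ℚ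
  1/k≡1 refl = refl

q*c≤1⇒q*a≤b : ∀ q a b c .{{_ : NonZero c}} → q ℚ.* toℚ c ℚ.≤ 1ℚ → a ≤ c * b → q ℚ.* toℚ a ℚ.≤ toℚ b
q*c≤1⇒q*a≤b q a b c qc≤1 a≤cb = ℚP.*-cancelʳ-≤-pos (toℚ c) {{ℚP.normalize-pos c 1}} (begin
  q ℚ.* toℚ a ℚ.* toℚ c       ≡⟨ ℚP.*-assoc q (toℚ a) (toℚ c) ⟩
  q ℚ.* (toℚ a ℚ.* toℚ c)     ≡⟨ cong (q ℚ.*_) (ℚP.*-comm (toℚ a) (toℚ c)) ⟩
  q ℚ.* (toℚ c ℚ.* toℚ a)     ≡⟨ ℚP.*-assoc q (toℚ c) (toℚ a) ⟨
  q ℚ.* toℚ c ℚ.* toℚ a       ≤⟨ ℚP.*-monoʳ-≤-nonNeg (toℚ a) {{ℚP.normalize-nonNeg a 1}} qc≤1 ⟩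
  1ℚ ℚ.* toℚ a                ≡⟨ ℚP.*-identityˡ (toℚ a) ⟩
  toℚ a                       ≤⟨ toℚ-mono-≤ a≤cb ⟩
  toℚ (c * b)                 ≡⟨ toℚ-* c b ⟩
  toℚ c ℚ.* toℚ b             ≡⟨ ℚP.*-comm (toℚ c) (toℚ b) ⟩
  toℚ b ℚ.* toℚ c             ∎)
  where open ℚP.≤-Reasoning

proposition6p4 : (d : ℕ) → 2 ≤ d → (q : ℚ)
                 → (∃[ δ ] ((0ℚ ℚ.< δ) × ((N : ℕ) → q ℚ.* toℚ (d !) ℚ.* ζPartial d N ℚ.≤ 1ℚ ℚ.- δ)))
                 → ∃[ M ] ((n : ℕ) → M ≤ n → q ℚ.* toℚ (n ^ d) ℚ.≤ toℚ (β n d))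
proposition6p4 d 2≤d q (δ , 0<δ , bound) = 2 + 1001 * (d * d) , λ
  { (suc m) (s≤s large) → q*c≤1⇒q*a≤b q (suc m ^ d) (β (suc m) d) (d !) {{d !≢0}} q*d!≤1 ([1+m]^d≤d!*β d m 2≤d large) }
  where
  open ℚP.≤-Reasoning
  q*d!≤1 : q ℚ.* toℚ (d !) ℚ.≤ 1ℚ
  q*d!≤1 = begin
    q ℚ.* toℚ (d !)                     ≡⟨ ℚP.*-identityʳ _ ⟨
    q ℚ.* toℚ (d !) ℚ.* 1ℚ              ≡⟨ cong (q ℚ.* toℚ (d !) ℚ.*_) (ζPartial-1 d) ⟨
    q ℚ.* toℚ (d !) ℚ.* ζPartial d 1    ≤⟨ bound 1 ⟩
    1ℚ ℚ.- δ                            ≤⟨ ℚP.+-monoʳ-≤ 1ℚ (ℚP.neg-antimono-≤ (ℚP.<⇒≤ 0<δ)) ⟩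
    1ℚ ℚ.+ 0ℚ                           ≡⟨ ℚP.+-identityʳ 1ℚ ⟩
    1ℚ                                  ∎
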